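{- Let $\mathcal A_{\mathrm{pol}}$ be a polynomial interpretation. If $\mathcal A_{\mathrm{pol}}$ is strictly monotone, then for every quasi-precedence $\succsim$ and status $\sigma$, $\succ_{\mathrm{WPO}(\mathcal A_{\mathrm{pol}})}$ is a reduction order.
   Context: Terms over a finite signature $\Sigma$ and variables $\mathcal V$. A polynomial interpretation $\mathcal A_{\mathrm{pol}}$ has carrier $\{a\in\mathbb N\mid a\ge w_0\}$ for some $w_0\in\mathbb N$, the usual orders $\ge,>$, and interprets each $f\in\Sigma_n$ as a polynomial $f_{\mathcal A}$ with natural-number coefficients mapping the carrier into itself. It is strictly monotone iff $a>b$ implies $f_{\mathcal A}(\dots,a,\dots)>f_{\mathcal A}(\dots,b,\dots)$ for all $f$ and argument positions. On terms, $s\ge_{\mathcal A}t$ ($>_{\mathcal A}$) iff $\hat\alpha(s)\ge\hat\alpha(t)$ ($>$) for all assignments $\alpha$. Quasi-precedence: quasi-order $\succsim$ on $\Sigma$ with well-founded strict part $\succ$, equivalence $\sim$. Status $\sigma$: $f\in\Sigma_n\mapsto$ permutation $[i_1..i_n]$, $\sigma(f)(s_1..s_n)=[s_{i_1},..,s_{i_n}]$. Lex extension of strict $\succ$ (reflexive closure $\succeq$): $[s_1..s_n]\succ^{\mathrm{lex}}[t_1..t_m]$ iff there is $k<n$ with $s_i\succeq t_i$ ($i\le k$) and either $k=m$, or $k<m$ and $s_{k+1}\succ t_{k+1}$. WPO: no variable is greater than any term; $s=f(s_1..s_n)\succ_{\mathrm{WPO}(\mathcal A)}t$ iff (1) $s>_{\mathcal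 A}t$, or (2) $s\ge_{\mathcal A}t$ and either $s_i\succeq_{\mathrm{WPO}(\mathcal A)}t$ for some $i$, or $t=g(t_1..t_m)$, $s\succ_{\mathrm{WPO}(\mathcal A)}t_j$ for all $j$, and $f\succ g$ or ($f\sim g$ and $\sigma(f)(\vec s)\succ^{\mathrm{lex}}_{\mathrm{WPO}(\mathcal A)}\sigma(g)(\vec t)$). A reduction order is a well-founded, monotonic and stable strict order on terms. -}

module Defs where

open import Data.Nat using (ℕ; _+_; _*_; _≤_; _<_)
open import Data.Fin using (Fin; toℕ; fromℕ<)
open import Data.Vec using (Vec; []; _∷_; lookup; tabulate; _[_]≔_)
open import Data.Fin.Permutation using (Permutation′; _⟨$⟩ʳ_)
open import Data.Product using (Σ; _×_; _,_)
open import Data.Sum using (_⊎_)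
open import Relation.Nullary using (¬_)
open import Relation.Binary.PropositionalEquality using (_≡_)
open import Relation.Binary.Structures using (IsStrictPartialOrder)
open import Induction.WellFounded using (WellFounded)
open import Function using (flip)

record Signature : Set where
  field
    size  : ℕ
    arity : Fin size → ℕ

open Signature public

Fun : Signature → Set
Fun S = Fin (size S)

data Term (S : Signature) : Set where
  var : ℕ → Term S
  fun : (f : Fun S) → Vec (Term S) (arity S f) → Term S

Subst : Signature → Set
Subst S = ℕ → Term S

mutual
  _⟨_⟩ : {S : Signature} → Term S → Subst S → Term S
  var x    ⟨ θ ⟩ = θ x
  fun f ts ⟨ θ ⟩ = fun f (ts ⟨ θ ⟩*)

  _⟨_⟩* : {S : Signature} {n : ℕ} → Vec (Term S) n → Subst S → Vec (Term S) n
  []       ⟨ θ ⟩* = []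
  (t ∷ ts) ⟨ θ ⟩* = (t ⟨ θ ⟩) ∷ (ts ⟨ θ ⟩*)

data Poly (n : ℕ) : Set where
  pvar  : Fin n → Poly n
  pcon  : ℕ → Poly n
  _⊕_   : Poly n → Poly n → Poly n
  _⊗_   : Poly n → Poly n → Poly n

evalPoly : {n : ℕ} → Poly n → Vec ℕ n → ℕ
evalPoly (pvar i)  v = lookup v i
evalPoly (pcon c)  v = c
evalPoly (p ⊕ q)   v = evalPoly p v + evalPoly q v
evalPoly (p ⊗ q)   v = evalPoly p v * evalPoly q v

-- Polynomial interpretations: carrier {a ∈ ℕ | a ≥ w₀}

record PolyInterpretation (S : Signature) : Set where
  field
    w₀     : ℕ
    interp : (f : Fun S) → Poly (arity S f)
    closed : (f : Fun S) (v : Vec ℕ (arity S f)) →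
             ((i : Fin (arity S f)) → w₀ ≤ lookup v i) →
             w₀ ≤ evalPoly (interp f) v

open PolyInterpretation public

module _ {S : Signature} (A : PolyInterpretation S) where

  InCarrier : {n : ℕ} → Vec ℕ n → Set
  InCarrier {n} v = (i : Fin n) → w₀ A ≤ lookup v i

  Assignment : Set
  Assignment = Σ (ℕ → ℕ) λ α → (x : ℕ) → w₀ A ≤ α x

  StrictlyMonotone : Set
  StrictlyMonotone =
    (f : Fun S) (v : Vec ℕ (arity S f)) (i : Fin (arity S f)) (a b : ℕ) →
    InCarrier v → w₀ A ≤ a → w₀ A ≤ b → b < a →
    evalPoly (interp A f) (v [ i ]≔ b) < evalPoly (interp A f) (v [ i ]≔ a)

  mutual
    ⟦_⟧ : Term S → (ℕ → ℕ) → ℕ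
    ⟦ var x ⟧    α = α x
    ⟦ fun f ts ⟧ α = evalPoly (interp A f) (⟦ ts ⟧* α)

    ⟦_⟧* : {n : ℕ} → Vec (Term S) n → (ℕ → ℕ) → Vec ℕ n
    ⟦ [] ⟧*     α = []
    ⟦ t ∷ ts ⟧* α = ⟦ t ⟧ α ∷ ⟦ ts ⟧* α

  _≥A_ : Term S → Term S → Set
  s ≥A t = (α : Assignment) → ⟦ t ⟧ (Σ.proj₁ α) ≤ ⟦ s ⟧ (Σ.proj₁ α)

  _>A_ : Term S → Term S → Set
  s >A t = (α : Assignment) → ⟦ t ⟧ (Σ.proj₁ α) < ⟦ s ⟧ (Σ.proj₁ α)

record QuasiPrecedence (S : Signature) : Set₁ where
  field
    _≿_   : Fun S → Fun S → Set
    refl≿  : (f : Fun S) → f ≿ f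
    trans≿ : {f g h : Fun S} → f ≿ g → g ≿ h → f ≿ h

  _≻ₚ_ : Fun S → Fun S → Set
  f ≻ₚ g = f ≿ g × ¬ (g ≿ f)

  _∼ₚ_ : Fun S → Fun S → Set
  f ∼ₚ g = f ≿ g × g ≿ f

  field
    wf≻ : WellFounded (flip _≻ₚ_)

open QuasiPrecedence public

Status : Signature → Set
Status S = (f : Fun S) → Permutation′ (arity S f)

-- σ(f)(s₁..sₙ) = [s_{i₁},..,s_{iₙ}] where σ(f) = [i₁..iₙ], i.e. i_j = σ f ⟨$⟩ʳ j
applyStatus : {S : Signature} → Status S → (f : Fun S) →
              Vec (Term S) (arity S f) → Vec (Term S) (arity S f)
applyStatus σ f ss = tabulate (λ j → lookup ss (σ f ⟨$⟩ʳ j))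

ReflClosure : {X : Set} → (X → X → Set) → X → X → Set
ReflClosure R s t = R s t ⊎ s ≡ t

-- [s₁..sₙ] ≻lex [t₁..tₘ] iff there is k < n with s_i ⪰ t_i (i ≤ k) and
-- either k = m, or k < m and s_{k+1} ≻ t_{k+1}.  (0-based indices below.)
Lex : {X : Set} → (X → X → Set) → {n m : ℕ} → Vec X n → Vec X m → Set
Lex R {n} {m} ss ts =
  Σ ℕ λ k → Σ (k < n) λ k<n →
    ((i : Fin n) (j : Fin m) → toℕ i ≡ toℕ j → toℕ i < k →
       ReflClosure R (lookup ss i) (lookup ts j))
    × (k ≡ m ⊎ Σ (k < m) λ k<m → R (lookup ss (fromℕ< k<n)) (lookup ts (fromℕ< k<m)))

module _ {S : Signature} (A : PolyInterpretation S)
         (P : QuasiPrecedence S) (σ : Status S) where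

  data WPO : Term S → Term S → Set where
    wpo1  : {f : Fun S} {ss : Vec (Term S) (arity S f)} {t : Term S} →
            _>A_ A (fun f ss) t → WPO (fun f ss) t
    wpo2a : {f : Fun S} {ss : Vec (Term S) (arity S f)} {t : Term S} →
            _≥A_ A (fun f ss) t → (i : Fin (arity S f)) →
            ReflClosure WPO (lookup ss i) t → WPO (fun f ss) t
    wpo2b : {f g : Fun S} {ss : Vec (Term S) (arity S f)}
            {ts : Vec (Term S) (arity S g)} →
            _≥A_ A (fun f ss) (fun g ts) →
            ((j : Fin (arity S g)) → WPO (fun f ss) (lookup ts j)) →
            (_≻ₚ_ P f g ⊎
              (_∼ₚ_ P f g × Lex WPO (applyStatus σ f ss) (applyStatus σ g ts))) →
            WPO (fun f ss) (fun g ts)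

module _ {S : Signature} (_≻_ : Term S → Term S → Set) where

  Monotonic : Set
  Monotonic = (f : Fun S) (ss : Vec (Term S) (arity S f)) (i : Fin (arity S f))
              (s t : Term S) → s ≻ t → fun f (ss [ i ]≔ s) ≻ fun f (ss [ i ]≔ t)

  Stable : Set
  Stable = (θ : Subst S) (s t : Term S) → s ≻ t → (s ⟨ θ ⟩) ≻ (t ⟨ θ ⟩)

  record IsReductionOrder : Set where
    field
      strictOrder : IsStrictPartialOrder _≡_ _≻_
      wellFounded : WellFounded (flip _≻_)
      monotonic   : Monotonic
      stable      : Stable

-- Strict monotonicity makes each polynomial, as a self-map of the carrier in
-- one argument, strictly increasing and hence inflationary, so every term is
-- weakly greater (≥_A) than its arguments: WPO contains the subterm relation,
-- which yields monotonicity. Stability follows from the substitution lemma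
-- ⟦ t θ ⟧α = ⟦ t ⟧(⟦ θ ⟧α), transitivity by induction on the greatest term.
-- For well-foundedness, a WPO step never increases the weight under the least
-- assignment and a (1)-step decreases it; below a fixed weight, f(s⃗) is
-- accessible once the sᵢ are, by induction on f along the precedence and on
-- σ(f)(s⃗) along the lexicographic order, which is well-founded on accessible
-- lists because the finite signature bounds their length.
module Submission where

open import Defs hiding (⟦_⟧; ⟦_⟧*; _≥A_; _>A_; _≿_; _≻ₚ_; _∼ₚ_; refl≿; trans≿; wf≻)
import Defs
open import Data.Nat using (ℕ; zero; suc; _⊔_; _≤_; _<_; _≤′_; ≤′-refl; ≤′-step; s≤s; z≤n)
open import Data.Nat.Properties
open import Data.Fin using (Fin; zero; suc; toℕ; fromℕ<) renaming (_≟_ to _≟ᶠ_)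
open import Data.Fin.Permutation using (Permutation′; _⟨$⟩ʳ_; _⟨$⟩ˡ_; inverseˡ; inverseʳ)
open import Data.Vec using (Vec; []; _∷_; lookup; tabulate; map; toList; _[_]≔_)
open import Data.Vec.Properties using (lookup∘update; lookup∘update′; []≔-lookup; lookup∘tabulate; tabulate∘lookup; tabulate-cong; tabulate-∘; lookup-map; toList-map; length-toList)
import Data.Vec.Relation.Unary.All as Allᵥ
open import Data.Vec.Relation.Unary.All.Properties using (tabulate⁺; toList⁺)
open import Data.List using (List; []; _∷_; length)
open import Data.List.Relation.Unary.All using (All; _∷_)
open import Data.List.Relation.Binary.Lex.Core using (Lex-<; base; halt; this; next)
open import Data.Product using (Σ; _×_; _,_; proj₁; proj₂)
open import Data.Sum using (_⊎_; inj₁; inj₂)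
open import Relation.Nullary using (yes; no)
open import Relation.Binary.PropositionalEquality
open import Induction.WellFounded using (Acc; acc; acc-inverse; WellFounded; wf⇒irrefl)
open import Function using (_∘_; flip)

strictlyIncreasing⇒inflationary :
  (w : ℕ) (h : ℕ → ℕ) → (∀ {a} → w ≤ a → w ≤ h a) → (∀ {a b} → w ≤ b → b < a → h b < h a) →
  ∀ {a} → w ≤′ a → a ≤ h a
strictlyIncreasing⇒inflationary w h closed strict ≤′-refl = closed ≤-refl
strictlyIncreasing⇒inflationary w h closed strict {suc a} (≤′-step w≤′a) =
  ≤-<-trans (strictlyIncreasing⇒inflationary w h closed strict w≤′a)
            (strict (≤′⇒≤ w≤′a) (n<1+n a))

evalPoly-mono : ∀ {n} (p : Poly n) {u v : Vec ℕ n} →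
                (∀ i → lookup u i ≤ lookup v i) → evalPoly p u ≤ evalPoly p v
evalPoly-mono (pvar i) u≤v = u≤v i
evalPoly-mono (pcon c) u≤v = ≤-refl
evalPoly-mono (p ⊕ q)  u≤v = +-mono-≤ (evalPoly-mono p u≤v) (evalPoly-mono q u≤v)
evalPoly-mono (p ⊗ q)  u≤v = *-mono-≤ (evalPoly-mono p u≤v) (evalPoly-mono q u≤v)

module _ {X : Set} where

  update-preserves : (P : X → Set) {n : ℕ} (xs : Vec X n) (i : Fin n) {x : X} →
                     (∀ j → P (lookup xs j)) → P x → ∀ j → P (lookup (xs [ i ]≔ x) j)
  update-preserves P xs i {x} Pxs Px j with j ≟ᶠ i
  ... | yes refl = subst P (sym (lookup∘update j xs x)) Px
  ... | no j≢i   = subst P (sym (lookup∘update′ j≢i xs x)) (Pxs j)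

  update-ReflClosure : (R : X → X → Set) {n : ℕ} (xs : Vec X n) (i : Fin n) {x y : X} →
                       R x y → ∀ j → ReflClosure R (lookup (xs [ i ]≔ x) j) (lookup (xs [ i ]≔ y) j)
  update-ReflClosure R xs i {x} {y} r j with j ≟ᶠ i
  ... | yes refl = inj₁ (subst₂ R (sym (lookup∘update j xs x)) (sym (lookup∘update j xs y)) r)
  ... | no j≢i   = inj₂ (trans (lookup∘update′ j≢i xs x) (sym (lookup∘update′ j≢i xs y)))

  permute-update : ∀ {n} (π : Permutation′ n) (xs : Vec X n) (i : Fin n) (x : X) →
                   tabulate (λ j → lookup (xs [ i ]≔ x) (π ⟨$⟩ʳ j))
                     ≡ tabulate (λ j → lookup xs (π ⟨$⟩ʳ j)) [ π ⟨$⟩ˡ i ]≔ x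
  permute-update {n} π xs i x = begin
    tabulate (λ j → lookup (xs [ i ]≔ x) (π ⟨$⟩ʳ j))  ≡⟨ tabulate-cong pointwise ⟩
    tabulate (lookup ys)                             ≡⟨ tabulate∘lookup ys ⟩
    ys                                               ∎
    where
    open ≡-Reasoning
    zs ys : Vec X n
    zs = tabulate (λ j → lookup xs (π ⟨$⟩ʳ j))
    ys = zs [ π ⟨$⟩ˡ i ]≔ x
    pointwise : ∀ j → lookup (xs [ i ]≔ x) (π ⟨$⟩ʳ j) ≡ lookup ys j
    pointwise j with j ≟ᶠ π ⟨$⟩ˡ i
    ... | yes refl = begin
      lookup (xs [ i ]≔ x) (π ⟨$⟩ʳ (π ⟨$⟩ˡ i)) ≡⟨ cong (lookup (xs [ i ]≔ x)) (inverseʳ π) ⟩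
      lookup (xs [ i ]≔ x) i                   ≡⟨ lookup∘update i xs x ⟩
      x                                        ≡⟨ lookup∘update j zs x ⟨
      lookup ys j                              ∎
    ... | no j≢k = begin
      lookup (xs [ i ]≔ x) (π ⟨$⟩ʳ j)          ≡⟨ lookup∘update′ πj≢i xs x ⟩
      lookup xs (π ⟨$⟩ʳ j)                     ≡⟨ lookup∘tabulate _ j ⟨
      lookup zs j                              ≡⟨ lookup∘update′ j≢k zs x ⟨
      lookup ys j                              ∎
      where
      πj≢i : π ⟨$⟩ʳ j ≢ i
      πj≢i πj≡i = j≢k (trans (sym (inverseˡ π)) (cong (π ⟨$⟩ˡ_) πj≡i))

module _ {X : Set} (R : X → X → Set) where

  private
    LexStop : ∀ {n m} → Vec X n → Vec X m → (k : ℕ) → k < n → Set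
    LexStop {m = m} xs ys k k<n =
      k ≡ m ⊎ Σ (k < m) λ k<m → R (lookup xs (fromℕ< k<n)) (lookup ys (fromℕ< k<m))

  -- The lexicographic extension only asks for sᵢ ⪰ tᵢ before position k, but
  -- the first strict sᵢ ≻ tᵢ already decides the comparison.
  Lex⇒Lex-< : ∀ {n m} (xs : Vec X n) (ys : Vec X m) →
              Lex R xs ys → Lex-< _≡_ (flip R) (toList ys) (toList xs)
  Lex⇒Lex-< [] _ (_ , () , _)
  Lex⇒Lex-< (x ∷ xs) [] _ = halt
  Lex⇒Lex-< (x ∷ xs) (y ∷ ys) (zero , _ , _ , inj₁ ())
  Lex⇒Lex-< (x ∷ xs) (y ∷ ys) (zero , _ , _ , inj₂ (_ , x>y)) = this x>y
  Lex⇒Lex-< (x ∷ xs) (y ∷ ys) (suc k , s≤s k<n , prefix , rest)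
    with prefix zero zero refl (s≤s z≤n)
  ... | inj₁ x>y  = this x>y
  ... | inj₂ refl = next refl (Lex⇒Lex-< xs ys (k , k<n , prefix′ , rest′ rest))
    where
    prefix′ : ∀ i j → toℕ i ≡ toℕ j → toℕ i < k → ReflClosure R (lookup xs i) (lookup ys j)
    prefix′ i j i≡j i<k = prefix (suc i) (suc j) (cong suc i≡j) (s≤s i<k)
    rest′ : LexStop (x ∷ xs) (y ∷ ys) (suc k) (s≤s k<n) → LexStop xs ys k k<n
    rest′ (inj₁ k+1≡m+1)         = inj₁ (suc-injective k+1≡m+1)
    rest′ (inj₂ (s≤s k<m , x>y)) = inj₂ (k<m , x>y)

  Lex-<⇒Lex : ∀ {n m} (xs : Vec X n) (ys : Vec X m) →
              Lex-< _≡_ (flip R) (toList ys) (toList xs) → Lex R xs ys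
  Lex-<⇒Lex [] [] (base ())
  Lex-<⇒Lex (x ∷ xs) [] halt = zero , s≤s z≤n , (λ _ _ _ ()) , inj₁ refl
  Lex-<⇒Lex (x ∷ xs) (y ∷ ys) (this x>y) =
    zero , s≤s z≤n , (λ _ _ _ ()) , inj₂ (s≤s z≤n , x>y)
  Lex-<⇒Lex (x ∷ xs) (y ∷ ys) (next refl ys<xs) with Lex-<⇒Lex xs ys ys<xs
  ... | k , k<n , prefix , rest = suc k , s≤s k<n , prefix′ , rest′ rest
    where
    prefix′ : ∀ i j → toℕ i ≡ toℕ j → toℕ i < suc k →
              ReflClosure R (lookup (x ∷ xs) i) (lookup (y ∷ ys) j)
    prefix′ zero    zero    _   _         = inj₂ refl
    prefix′ (suc i) (suc j) i≡j (s≤s i<k) = prefix i j (suc-injective i≡j) i<k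
    rest′ : LexStop xs ys k k<n → LexStop (x ∷ xs) (y ∷ ys) (suc k) (s≤s k<n)
    rest′ (inj₁ k≡m)          = inj₁ (cong suc k≡m)
    rest′ (inj₂ (k<m , x>y))  = inj₂ (s≤s k<m , x>y)

TransitiveAt : {X : Set} → (X → X → Set) → X → Set
TransitiveAt _<_ x = ∀ {y z} → z < y → y < x → z < x

-- Lexicographic descent is well-founded only on lists of bounded length
-- whose entries are accessible.
BoundedLex : {X : Set} → (X → X → Set) → ℕ → List X → List X → Set
BoundedLex _<_ N ys xs = Lex-< _≡_ _<_ ys xs × length ys ≤ N × All (Acc _<_) ys

module _ {X : Set} {_<_ : X → X → Set} where

  Lex-<-transitiveAt : ∀ {xs ys zs} → All (TransitiveAt _<_) xs →
                       Lex-< _≡_ _<_ zs ys → Lex-< _≡_ _<_ ys xs → Lex-< _≡_ _<_ zs xs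
  Lex-<-transitiveAt _          (base ())    _
  Lex-<-transitiveAt _          halt         (this _)     = halt
  Lex-<-transitiveAt _          halt         (next _ _)   = halt
  Lex-<-transitiveAt (tx ∷ _)   (this z<y)   (this y<x)   = this (tx z<y y<x)
  Lex-<-transitiveAt _          (this z<y)   (next refl _) = this z<y
  Lex-<-transitiveAt _          (next refl _) (this y<x)  = this y<x
  Lex-<-transitiveAt (_ ∷ txs)  (next refl zs<ys) (next refl ys<xs) =
    next refl (Lex-<-transitiveAt txs zs<ys ys<xs)

  Lex-<-update : ∀ {n} (xs : Vec X n) (k : Fin n) {x y : X} →
                 y < x → Lex-< _≡_ _<_ (toList (xs [ k ]≔ y)) (toList (xs [ k ]≔ x))
  Lex-<-update (_ ∷ xs) zero    y<x = this y<x
  Lex-<-update (_ ∷ xs) (suc k) y<x = next refl (Lex-<-update xs k y<x)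

  Lex-<-map : {Y : Set} {_<′_ : Y → Y → Set} (F : X → Y) {xs ys : List X} →
              All (λ x → ∀ {y} → y < x → F y <′ F x) xs →
              Lex-< _≡_ _<_ ys xs → Lex-< _≡_ _<′_ (Data.List.map F ys) (Data.List.map F xs)
  Lex-<-map F _        (base ())
  Lex-<-map F _        halt            = halt
  Lex-<-map F (Fx ∷ _) (this y<x)      = this (Fx y<x)
  Lex-<-map F (_ ∷ Fs) (next refl ys<xs) = next refl (Lex-<-map F Fs ys<xs)

  []-accessible : ∀ {N} → Acc (BoundedLex _<_ N) []
  []-accessible = acc λ { {[]} (base () , _) }

  mutual
    BoundedLex-acc : ∀ N {xs} → length xs ≤ N → All (Acc _<_) xs →
                     Acc (BoundedLex _<_ N) xs
    BoundedLex-acc N       {[]}     _         _           = []-accessible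
    BoundedLex-acc (suc N) {x ∷ xs} (s≤s len) (ax ∷ axs) = ∷-acc ax (BoundedLex-acc N len axs)

    ∷-acc : ∀ {N x xs} → Acc _<_ x → Acc (BoundedLex _<_ N) xs →
            Acc (BoundedLex _<_ (suc N)) (x ∷ xs)
    ∷-acc ax axs = acc (∷-acc-below ax axs)

    ∷-acc-below : ∀ {N x xs} → Acc _<_ x → Acc (BoundedLex _<_ N) xs →
                  ∀ {ys} → BoundedLex _<_ (suc N) ys (x ∷ xs) → Acc (BoundedLex _<_ (suc N)) ys
    ∷-acc-below _         _          {[]}     _ = []-accessible
    ∷-acc-below (acc x↓) _          {y ∷ ys} (this y<x , s≤s len , _ ∷ ays) =
      ∷-acc (x↓ y<x) (BoundedLex-acc _ len ays)
    ∷-acc-below ax        (acc xs↓) {y ∷ ys} (next refl ys<xs , s≤s len , _ ∷ ays) =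
      ∷-acc ax (xs↓ (ys<xs , len , ays))

Lex-map : {X Y : Set} {R : X → X → Set} {R′ : Y → Y → Set} (F : X → Y) →
          ∀ {n m} (xs : Vec X n) (ys : Vec X m) →
          Allᵥ.All (λ x → ∀ {y} → R x y → R′ (F x) (F y)) xs →
          Lex R xs ys → Lex R′ (map F xs) (map F ys)
Lex-map {R = R} {R′ = R′} F xs ys Fs xs>ys =
  Lex-<⇒Lex R′ (map F xs) (map F ys)
    (subst₂ (Lex-< _≡_ (flip R′)) (sym (toList-map F ys)) (sym (toList-map F xs))
            (Lex-<-map F (toList⁺ Fs) (Lex⇒Lex-< R xs ys xs>ys)))

max-over : (n : ℕ) → (Fin n → ℕ) → ℕ
max-over zero    _ = 0
max-over (suc n) a = a zero ⊔ max-over n (a ∘ suc)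

≤-max-over : ∀ n (a : Fin n → ℕ) (i : Fin n) → a i ≤ max-over n a
≤-max-over (suc n) a zero    = m≤m⊔n (a zero) _
≤-max-over (suc n) a (suc i) = ≤-trans (≤-max-over n (a ∘ suc) i) (m≤n⊔m (a zero) _)

module Precedence {S : Signature} (P : QuasiPrecedence S) where
  open QuasiPrecedence P

  ∼ₚ-refl : ∀ f → f ∼ₚ f
  ∼ₚ-refl f = refl≿ f , refl≿ f

  ∼ₚ-sym : ∀ {f g} → f ∼ₚ g → g ∼ₚ f
  ∼ₚ-sym (f≿g , g≿f) = g≿f , f≿g

  ∼ₚ-trans : ∀ {f g h} → f ∼ₚ g → g ∼ₚ h → f ∼ₚ h
  ∼ₚ-trans (f≿g , g≿f) (g≿h , h≿g) = trans≿ f≿g g≿h , trans≿ h≿g g≿f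

  ≻ₚ-≿-trans : ∀ {f g h} → f ≻ₚ g → g ≿ h → f ≻ₚ h
  ≻ₚ-≿-trans (f≿g , g⋡f) g≿h = trans≿ f≿g g≿h , λ h≿f → g⋡f (trans≿ g≿h h≿f)

  ≿-≻ₚ-trans : ∀ {f g h} → f ≿ g → g ≻ₚ h → f ≻ₚ h
  ≿-≻ₚ-trans f≿g (g≿h , h⋡g) = trans≿ f≿g g≿h , λ h≿f → h⋡g (trans≿ h≿f f≿g)

module _ {S : Signature} where

  ⟨⟩*≡map : ∀ {n} (ts : Vec (Term S) n) (θ : Subst S) → ts ⟨ θ ⟩* ≡ map (_⟨ θ ⟩) ts
  ⟨⟩*≡map []       θ = refl
  ⟨⟩*≡map (t ∷ ts) θ = cong (t ⟨ θ ⟩ ∷_) (⟨⟩*≡map ts θ)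

  lookup-⟨⟩* : ∀ {n} (ts : Vec (Term S) n) (θ : Subst S) (i : Fin n) →
               lookup (ts ⟨ θ ⟩*) i ≡ lookup ts i ⟨ θ ⟩
  lookup-⟨⟩* ts θ i = trans (cong (λ us → lookup us i) (⟨⟩*≡map ts θ)) (lookup-map i _ ts)

module Interpretation {S : Signature} (A : PolyInterpretation S) where

  ⟦_⟧ : Term S → (ℕ → ℕ) → ℕ
  ⟦_⟧ = Defs.⟦_⟧ A

  ⟦_⟧* : ∀ {n} → Vec (Term S) n → (ℕ → ℕ) → Vec ℕ n
  ⟦_⟧* = Defs.⟦_⟧* A

  infix 4 _≥ₐ_ _>ₐ_
  _≥ₐ_ _>ₐ_ : Term S → Term S → Set
  _≥ₐ_ = Defs._≥A_ A
  _>ₐ_ = Defs._>A_ A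

  ⟦⟧*≡map : ∀ {n} (ts : Vec (Term S) n) (α : ℕ → ℕ) → ⟦ ts ⟧* α ≡ map (λ t → ⟦ t ⟧ α) ts
  ⟦⟧*≡map []       α = refl
  ⟦⟧*≡map (t ∷ ts) α = cong (⟦ t ⟧ α ∷_) (⟦⟧*≡map ts α)

  lookup-⟦⟧* : ∀ {n} (ts : Vec (Term S) n) (α : ℕ → ℕ) (i : Fin n) →
               lookup (⟦ ts ⟧* α) i ≡ ⟦ lookup ts i ⟧ α
  lookup-⟦⟧* ts α i = trans (cong (λ v → lookup v i) (⟦⟧*≡map ts α)) (lookup-map i _ ts)

  mutual
    ⟦⟧-inCarrier : (α : Assignment A) (t : Term S) → w₀ A ≤ ⟦ t ⟧ (proj₁ α)
    ⟦⟧-inCarrier α (var x)    = proj₂ α x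
    ⟦⟧-inCarrier α (fun f ts) = closed A f _ (⟦⟧*-inCarrier α ts)

    ⟦⟧*-inCarrier : ∀ {n} (α : Assignment A) (ts : Vec (Term S) n) →
                    InCarrier A (⟦ ts ⟧* (proj₁ α))
    ⟦⟧*-inCarrier α (t ∷ ts) zero    = ⟦⟧-inCarrier α t
    ⟦⟧*-inCarrier α (t ∷ ts) (suc i) = ⟦⟧*-inCarrier α ts i

  module _ (θ : Subst S) where

    mutual
      ⟦⟧-⟨⟩ : (t : Term S) (α : ℕ → ℕ) → ⟦ t ⟨ θ ⟩ ⟧ α ≡ ⟦ t ⟧ (λ x → ⟦ θ x ⟧ α)
      ⟦⟧-⟨⟩ (var x)    α = refl
      ⟦⟧-⟨⟩ (fun f ts) α = cong (evalPoly (interp A f)) (⟦⟧*-⟨⟩ ts α)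

      ⟦⟧*-⟨⟩ : ∀ {n} (ts : Vec (Term S) n) (α : ℕ → ℕ) →
               ⟦ ts ⟨ θ ⟩* ⟧* α ≡ ⟦ ts ⟧* (λ x → ⟦ θ x ⟧ α)
      ⟦⟧*-⟨⟩ []       α = refl
      ⟦⟧*-⟨⟩ (t ∷ ts) α = cong₂ _∷_ (⟦⟧-⟨⟩ t α) (⟦⟧*-⟨⟩ ts α)

    substituted : Assignment A → Assignment A
    substituted α = (λ x → ⟦ θ x ⟧ (proj₁ α)) , (λ x → ⟦⟧-inCarrier α (θ x))

    ≥ₐ-⟨⟩ : ∀ s t → s ≥ₐ t → s ⟨ θ ⟩ ≥ₐ t ⟨ θ ⟩
    ≥ₐ-⟨⟩ s t s≥t α =
      subst₂ _≤_ (sym (⟦⟧-⟨⟩ t (proj₁ α))) (sym (⟦⟧-⟨⟩ s (proj₁ α))) (s≥t (substituted α))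

    >ₐ-⟨⟩ : ∀ s t → s >ₐ t → s ⟨ θ ⟩ >ₐ t ⟨ θ ⟩
    >ₐ-⟨⟩ s t s>t α =
      subst₂ _<_ (sym (⟦⟧-⟨⟩ t (proj₁ α))) (sym (⟦⟧-⟨⟩ s (proj₁ α))) (s>t (substituted α))

  fun-≥ₐ : ∀ f (ss ts : Vec (Term S) (arity S f)) →
           (∀ i → lookup ss i ≥ₐ lookup ts i) → fun f ss ≥ₐ fun f ts
  fun-≥ₐ f ss ts ss≥ts α = evalPoly-mono (interp A f) λ i → begin
    lookup (⟦ ts ⟧* (proj₁ α)) i ≡⟨ lookup-⟦⟧* ts (proj₁ α) i ⟩
    ⟦ lookup ts i ⟧ (proj₁ α)    ≤⟨ ss≥ts i α ⟩
    ⟦ lookup ss i ⟧ (proj₁ α)    ≡⟨ lookup-⟦⟧* ss (proj₁ α) i ⟨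
    lookup (⟦ ss ⟧* (proj₁ α)) i ∎
    where open ≤-Reasoning

  module _ (strictlyMonotone : StrictlyMonotone A) where

    lookup≤evalPoly : ∀ f {v : Vec ℕ (arity S f)} → InCarrier A v →
                      ∀ i → lookup v i ≤ evalPoly (interp A f) v
    lookup≤evalPoly f {v} v∈C i =
      subst (λ u → lookup v i ≤ evalPoly (interp A f) u) ([]≔-lookup v i)
        (strictlyIncreasing⇒inflationary (w₀ A) (λ a → evalPoly (interp A f) (v [ i ]≔ a))
           (λ w≤a → closed A f _ (update-preserves (w₀ A ≤_) v i v∈C w≤a))
           (λ w≤b b<a → strictlyMonotone f v i _ _ v∈C (≤-trans w≤b (<⇒≤ b<a)) w≤b b<a)
           (≤⇒≤′ (v∈C i)))

    fun≥ₐarg : ∀ f (ss : Vec (Term S) (arity S f)) i → fun f ss ≥ₐ lookup ss i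
    fun≥ₐarg f ss i α =
      subst (_≤ ⟦ fun f ss ⟧ (proj₁ α)) (lookup-⟦⟧* ss (proj₁ α) i)
        (lookup≤evalPoly f (⟦⟧*-inCarrier α ss) i)

module _ {S : Signature} (σ : Status S) (f : Fun S) where

  applyStatus-All : (P : Term S → Set) (ss : Vec (Term S) (arity S f)) →
                    (∀ i → P (lookup ss i)) → Allᵥ.All P (applyStatus σ f ss)
  applyStatus-All P ss Pss = tabulate⁺ (λ j → Pss (σ f ⟨$⟩ʳ j))

  applyStatus-map : (F : Term S → Term S) (ss : Vec (Term S) (arity S f)) →
                    applyStatus σ f (map F ss) ≡ map F (applyStatus σ f ss)
  applyStatus-map F ss =
    trans (tabulate-cong (λ j → lookup-map (σ f ⟨$⟩ʳ j) F ss)) (tabulate-∘ F _)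

  applyStatus-update : (ss : Vec (Term S) (arity S f)) (i : Fin (arity S f)) (s : Term S) →
                       applyStatus σ f (ss [ i ]≔ s) ≡ applyStatus σ f ss [ σ f ⟨$⟩ˡ i ]≔ s
  applyStatus-update = permute-update (σ f)

  length-applyStatus : (ss : Vec (Term S) (arity S f)) →
                       length (toList (applyStatus σ f ss)) ≤ max-over (size S) (arity S)
  length-applyStatus ss =
    ≤-trans (≤-reflexive (length-toList (applyStatus σ f ss))) (≤-max-over _ (arity S) f)

module WPOProperties {S : Signature} (A : PolyInterpretation S)
                     (strictlyMonotone : StrictlyMonotone A)
                     (P : QuasiPrecedence S) (σ : Status S) where
  open Interpretation A
  open QuasiPrecedence P using (_≻ₚ_; _∼ₚ_; wf≻)
  open Precedence P

  infix 4 _≻_ _≺_ _⪰_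
  _≻_ _≺_ _⪰_ : Term S → Term S → Set
  _≻_   = WPO A P σ
  t ≺ s = s ≻ t
  _⪰_   = ReflClosure _≻_

  ≻⇒≥ₐ : ∀ {s t} → s ≻ t → s ≥ₐ t
  ≻⇒≥ₐ (wpo1 s>t) α     = <⇒≤ (s>t α)
  ≻⇒≥ₐ (wpo2a s≥t _ _) = s≥t
  ≻⇒≥ₐ (wpo2b s≥t _ _) = s≥t

  ⪰⇒≥ₐ : ∀ {s t} → s ⪰ t → s ≥ₐ t
  ⪰⇒≥ₐ (inj₁ s≻t)  = ≻⇒≥ₐ s≻t
  ⪰⇒≥ₐ (inj₂ refl) α = ≤-refl

  PrecedenceOrLex : ∀ f → Vec (Term S) (arity S f) → ∀ g → Vec (Term S) (arity S g) → Set
  PrecedenceOrLex f ss g ts =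
    f ≻ₚ g ⊎ (f ∼ₚ g × Lex _≻_ (applyStatus σ f ss) (applyStatus σ g ts))

  statusList : ∀ f → Vec (Term S) (arity S f) → List (Term S)
  statusList f ss = toList (applyStatus σ f ss)

  statusList-All : (Q : Term S → Set) → ∀ f (ss : Vec (Term S) (arity S f)) →
                   (∀ i → Q (lookup ss i)) → All Q (statusList f ss)
  statusList-All Q f ss Qss = toList⁺ (applyStatus-All σ f Q ss Qss)

  trans-fun : ∀ f (ss : Vec (Term S) (arity S f)) →
              (∀ i → TransitiveAt _≺_ (lookup ss i)) → TransitiveAt _≺_ (fun f ss)
  trans-fun f ss ss-trans t≻u (wpo1 s>t) = wpo1 (λ α → ≤-<-trans (≻⇒≥ₐ t≻u α) (s>t α))
  trans-fun f ss ss-trans {t} {u} t≻u (wpo2a s≥t i si⪰t) =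
    wpo2a (λ α → ≤-trans (≻⇒≥ₐ t≻u α) (s≥t α)) i (inj₁ (via si⪰t))
    where
    via : lookup ss i ⪰ t → lookup ss i ≻ u
    via (inj₁ si≻t) = ss-trans i t≻u si≻t
    via (inj₂ refl) = t≻u
  trans-fun f ss ss-trans (wpo1 t>u) (wpo2b s≥t _ _) = wpo1 (λ α → <-≤-trans (t>u α) (s≥t α))
  trans-fun f ss ss-trans (wpo2a _ j (inj₁ tj≻u)) (wpo2b _ s≻ts _) =
    trans-fun f ss ss-trans tj≻u (s≻ts j)
  trans-fun f ss ss-trans (wpo2a _ j (inj₂ refl)) (wpo2b _ s≻ts _) = s≻ts j
  trans-fun f ss ss-trans (wpo2b {ss = ts} {ts = us} t≥u t≻us t▷u) s≻t@(wpo2b s≥t _ s▷t) =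
    wpo2b (λ α → ≤-trans (t≥u α) (s≥t α)) (λ k → trans-fun f ss ss-trans (t≻us k) s≻t)
          (PrecedenceOrLex-trans ts us s▷t t▷u)
    where
    PrecedenceOrLex-trans :
      ∀ {g h} (ts : Vec (Term S) (arity S g)) (us : Vec (Term S) (arity S h)) →
      PrecedenceOrLex f ss g ts → PrecedenceOrLex g ts h us → PrecedenceOrLex f ss h us
    PrecedenceOrLex-trans _ _ (inj₁ f≻g) (inj₁ g≻h) = inj₁ (≻ₚ-≿-trans f≻g (proj₁ g≻h))
    PrecedenceOrLex-trans _ _ (inj₁ f≻g) (inj₂ (g∼h , _)) = inj₁ (≻ₚ-≿-trans f≻g (proj₁ g∼h))
    PrecedenceOrLex-trans _ _ (inj₂ (f∼g , _)) (inj₁ g≻h) = inj₁ (≿-≻ₚ-trans (proj₁ f∼g) g≻h)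
    PrecedenceOrLex-trans {g} {h} ts us (inj₂ (f∼g , ss>ts)) (inj₂ (g∼h , ts>us)) =
      inj₂ (∼ₚ-trans f∼g g∼h ,
            Lex-<⇒Lex _≻_ Fss Hus
              (Lex-<-transitiveAt (statusList-All (TransitiveAt _≺_) f ss ss-trans)
                                  (Lex⇒Lex-< _≻_ Gts Hus ts>us) (Lex⇒Lex-< _≻_ Fss Gts ss>ts)))
      where
      Fss : Vec (Term S) (arity S f)
      Gts : Vec (Term S) (arity S g)
      Hus : Vec (Term S) (arity S h)
      Fss = applyStatus σ f ss
      Gts = applyStatus σ g ts
      Hus = applyStatus σ h us

  mutual
    transitiveAt : ∀ s → TransitiveAt _≺_ s
    transitiveAt (fun f ss) = trans-fun f ss (transitiveAt* ss)

    transitiveAt* : ∀ {n} (ss : Vec (Term S) n) i → TransitiveAt _≺_ (lookup ss i)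
    transitiveAt* (s ∷ ss) zero    = transitiveAt s
    transitiveAt* (s ∷ ss) (suc i) = transitiveAt* ss i

  ≻-trans : ∀ {s t u} → s ≻ t → t ≻ u → s ≻ u
  ≻-trans {s} s≻t t≻u = transitiveAt s t≻u s≻t

  module _ (θ : Subst S) where

    StableAt : Term S → Set
    StableAt s = ∀ {t} → s ≻ t → s ⟨ θ ⟩ ≻ t ⟨ θ ⟩

    applyStatus-⟨⟩ : ∀ f (ss : Vec (Term S) (arity S f)) →
                     applyStatus σ f (ss ⟨ θ ⟩*) ≡ map (_⟨ θ ⟩) (applyStatus σ f ss)
    applyStatus-⟨⟩ f ss =
      trans (cong (applyStatus σ f) (⟨⟩*≡map ss θ)) (applyStatus-map σ f (_⟨ θ ⟩) ss)

    stable-fun : ∀ f (ss : Vec (Term S) (arity S f)) →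
                 (∀ i → StableAt (lookup ss i)) → StableAt (fun f ss)
    stable-fun f ss ss-stable {t} (wpo1 s>t) = wpo1 (>ₐ-⟨⟩ θ (fun f ss) t s>t)
    stable-fun f ss ss-stable {t} (wpo2a s≥t i (inj₁ si≻t)) =
      wpo2a (≥ₐ-⟨⟩ θ (fun f ss) t s≥t) i
            (inj₁ (subst (_≻ t ⟨ θ ⟩) (sym (lookup-⟨⟩* ss θ i)) (ss-stable i si≻t)))
    stable-fun f ss ss-stable {t} (wpo2a s≥t i (inj₂ refl)) =
      wpo2a (≥ₐ-⟨⟩ θ (fun f ss) t s≥t) i (inj₂ (lookup-⟨⟩* ss θ i))
    stable-fun f ss ss-stable (wpo2b {g = g} {ts = ts} s≥t s≻ts f▷g) =
      wpo2b (≥ₐ-⟨⟩ θ (fun f ss) (fun g ts) s≥t)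
            (λ j → subst (fun f (ss ⟨ θ ⟩*) ≻_) (sym (lookup-⟨⟩* ts θ j))
                         (stable-fun f ss ss-stable (s≻ts j)))
            (PrecedenceOrLex-⟨⟩ f▷g)
      where
      PrecedenceOrLex-⟨⟩ : PrecedenceOrLex f ss g ts → PrecedenceOrLex f (ss ⟨ θ ⟩*) g (ts ⟨ θ ⟩*)
      PrecedenceOrLex-⟨⟩ (inj₁ f≻g)          = inj₁ f≻g
      PrecedenceOrLex-⟨⟩ (inj₂ (f∼g , ss>ts)) =
        inj₂ (f∼g , subst₂ (Lex _≻_) (sym (applyStatus-⟨⟩ f ss)) (sym (applyStatus-⟨⟩ g ts))
                      (Lex-map {R′ = _≻_} (_⟨ θ ⟩) (applyStatus σ f ss) (applyStatus σ g ts)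
                                            (applyStatus-All σ f StableAt ss ss-stable) ss>ts))

    mutual
      stableAt : ∀ s → StableAt s
      stableAt (fun f ss) = stable-fun f ss (stableAt* ss)

      stableAt* : ∀ {n} (ss : Vec (Term S) n) i → StableAt (lookup ss i)
      stableAt* (s ∷ ss) zero    = stableAt s
      stableAt* (s ∷ ss) (suc i) = stableAt* ss i

  ≻-stable : Stable _≻_
  ≻-stable θ s t = stableAt θ s

  ≻-monotonic : Monotonic _≻_
  ≻-monotonic f ss i s t s≻t =
    wpo2b (fun-≥ₐ f us vs (λ j → ⪰⇒≥ₐ (us⪰vs j))) us≻vs (inj₂ (∼ₚ-refl f , status>))
    where
    us vs : Vec (Term S) (arity S f)
    us = ss [ i ]≔ s
    vs = ss [ i ]≔ t

    us⪰vs : ∀ j → lookup us j ⪰ lookup vs j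
    us⪰vs = update-ReflClosure _≻_ ss i s≻t

    us≻vs : ∀ j → fun f us ≻ lookup vs j
    us≻vs j =
      wpo2a (λ α → ≤-trans (⪰⇒≥ₐ (us⪰vs j) α) (fun≥ₐarg strictlyMonotone f us j α)) j (us⪰vs j)

    k : Fin (arity S f)
    k = σ f ⟨$⟩ˡ i

    status> : Lex _≻_ (applyStatus σ f us) (applyStatus σ f vs)
    status> =
      subst₂ (Lex _≻_) (sym (applyStatus-update σ f ss i s)) (sym (applyStatus-update σ f ss i t))
        (Lex-<⇒Lex _≻_ (applyStatus σ f ss [ k ]≔ s) (applyStatus σ f ss [ k ]≔ t)
                       (Lex-<-update (applyStatus σ f ss) k s≻t))

  weight : Term S → ℕ
  weight t = ⟦ t ⟧ (λ _ → w₀ A)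

  least : Assignment A
  least = (λ _ → w₀ A) , (λ _ → ≤-refl)

  _⊏_ : List (Term S) → List (Term S) → Set
  _⊏_ = BoundedLex _≺_ (max-over (size S) (arity S))

  statusList-acc : ∀ f (ss : Vec (Term S) (arity S f)) →
                   (∀ i → Acc _≺_ (lookup ss i)) → Acc _⊏_ (statusList f ss)
  statusList-acc f ss ss↓ =
    BoundedLex-acc _ (length-applyStatus σ f ss) (statusList-All (Acc _≺_) f ss ss↓)

  module _ (w : ℕ) (lighter-acc : ∀ t → weight t < w → Acc _≺_ t) where

    -- The precedence is only a quasi-order, so its accessibility is carried by
    -- a representative f of the ∼ₚ-class of the head symbol g.
    mutual
      fun-acc : ∀ {f g} → Acc (flip _≻ₚ_) f → g ∼ₚ f →
                ∀ ss → (∀ i → Acc _≺_ (lookup ss i)) → weight (fun g ss) ≤ w →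
                Acc _⊏_ (statusList g ss) → Acc _≺_ (fun g ss)
      fun-acc f↓ g∼f ss ss↓ ≤w st↓ = acc (fun-acc-below f↓ g∼f ss ss↓ ≤w st↓)

      fun-acc-below : ∀ {f g} → Acc (flip _≻ₚ_) f → g ∼ₚ f →
                      ∀ ss → (∀ i → Acc _≺_ (lookup ss i)) → weight (fun g ss) ≤ w →
                      Acc _⊏_ (statusList g ss) → ∀ {t} → t ≺ fun g ss → Acc _≺_ t
      fun-acc-below _ _ _ _ ≤w _ {t} (wpo1 s>t) = lighter-acc t (<-≤-trans (s>t least) ≤w)
      fun-acc-below _ _ _ ss↓ _ _ (wpo2a _ i (inj₁ si≻t)) = acc-inverse (ss↓ i) si≻t
      fun-acc-below _ _ _ ss↓ _ _ (wpo2a _ i (inj₂ refl)) = ss↓ i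
      fun-acc-below f↓@(acc f↓<) g∼f ss ss↓ ≤w st↓ (wpo2b {g = h} {ts = ts} s≥t s≻ts (inj₁ g≻h)) =
        let ts↓ : ∀ j → Acc _≺_ (lookup ts j)
            ts↓ j = fun-acc-below f↓ g∼f ss ss↓ ≤w st↓ (s≻ts j)
        in
        fun-acc (f↓< (≿-≻ₚ-trans (proj₂ g∼f) g≻h)) (∼ₚ-refl h) ts ts↓ (≤-trans (s≥t least) ≤w)
                (statusList-acc h ts ts↓)
      fun-acc-below f↓ g∼f ss ss↓ ≤w st↓@(acc st↓<)
                    (wpo2b {g = h} {ts = ts} s≥t s≻ts (inj₂ (g∼h , ss>ts))) =
        let ts↓ : ∀ j → Acc _≺_ (lookup ts j)
            ts↓ j = fun-acc-below f↓ g∼f ss ss↓ ≤w st↓ (s≻ts j)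
        in
        fun-acc f↓ (∼ₚ-trans (∼ₚ-sym g∼h) g∼f) ts ts↓ (≤-trans (s≥t least) ≤w)
                (st↓< (Lex⇒Lex-< _≻_ _ _ ss>ts , length-applyStatus σ h ts ,
                       statusList-All (Acc _≺_) h ts ts↓))

    mutual
      ≤w-acc : ∀ t → weight t ≤ w → Acc _≺_ t
      ≤w-acc (var x)    _  = acc λ ()
      ≤w-acc (fun f ss) ≤w = fun-acc (wf≻ f) (∼ₚ-refl f) ss ss↓ ≤w (statusList-acc f ss ss↓)
        where
        ss↓ : ∀ i → Acc _≺_ (lookup ss i)
        ss↓ = ≤w-acc* ss (λ i → ≤-trans (fun≥ₐarg strictlyMonotone f ss i least) ≤w)

      ≤w-acc* : ∀ {n} (ss : Vec (Term S) n) → (∀ i → weight (lookup ss i) ≤ w) →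
                ∀ i → Acc _≺_ (lookup ss i)
      ≤w-acc* (s ∷ ss) ≤w zero    = ≤w-acc s (≤w zero)
      ≤w-acc* (s ∷ ss) ≤w (suc i) = ≤w-acc* ss (≤w ∘ suc) i

  weight-acc : ∀ w t → weight t ≤ w → Acc _≺_ t
  weight-acc zero    = ≤w-acc zero (λ _ ())
  weight-acc (suc w) = ≤w-acc (suc w) (λ t t<1+w → weight-acc w t (≤-pred t<1+w))

  ≻-wellFounded : WellFounded _≺_
  ≻-wellFounded t = weight-acc (weight t) t ≤-refl

corollary2 : {S : Signature} (A : PolyInterpretation S) →
    StrictlyMonotone A →
    (P : QuasiPrecedence S) (σ : Status S) →
    IsReductionOrder (WPO A P σ)
corollary2 A strictlyMonotone P σ = record
  { strictOrder = record
      { isEquivalence = isEquivalence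
      ; irrefl        = λ x≡y → wf⇒irrefl (resp₂ _≺_) sym ≻-wellFounded (sym x≡y)
      ; trans         = ≻-trans
      ; <-resp-≈      = resp₂ _≻_
      }
  ; wellFounded = ≻-wellFounded
  ; monotonic   = ≻-monotonic
  ; stable      = ≻-stable
  }
  where open WPOProperties A strictlyMonotone P σ
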